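{- Let $G$ be a (finite, simple) $(2k+1)$-regular graph containing a perfect matching $M$, and let $F$ be a $2$-factor of $G\setminus M$. Let $k_1,k_2$ be positive integers with $k_1+k_2=k-1$. If for every two vertices $u,v$ adjacent in $F$ we have $|N_G(u)\cap N_G(v)|\leq k_1-1$, then $G$ is $\{S_{k_1,k_2},S_{k_1+1,k_2}\}$-decomposable.
   Context: $N_G(u)$ is the set of neighbors of $u$ in $G$; $G\setminus M$ is the graph obtained from $G$ by deleting the edges of $M$. A $2$-factor is a spanning subgraph in which every vertex has degree $2$. For positive integers $a,b$, $S_{a,b}$ denotes the double-star with degree sequence $(a+1,b+1,1,\ldots,1)$, i.e. the tree obtained from an edge $u_1u_2$ by attaching $a$ pendant vertices to $u_1$ and $b$ pendant vertices to $u_2$. A graph $G$ is $\{H_1,\ldots,H_m\}$-decomposable if $E(G)$ can be partitioned into subsets each of which forms a subgraph isomorphic to some $H_i$. -}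

module Defs where

open import Data.Nat using (ℕ; zero; suc; _+_; _*_; _∸_; _≤_)
open import Data.Bool using (Bool; true; false; _∧_; _∨_; if_then_else_; T)
open import Data.Fin using (Fin; _≟_)
open import Data.List using (List; []; _∷_; map; _++_; allFin)
open import Data.Nat.ListAction using (sum)
open import Data.Bool.ListAction using (any)
open import Data.Vec using (Vec; toList)
open import Data.List.Relation.Unary.All using (All)
open import Data.List.Relation.Unary.Unique.Propositional using (Unique)
open import Data.Product using (_×_; _,_)
open import Data.Sum using (_⊎_)
open import Relation.Binary.PropositionalEquality using (_≡_)
open import Relation.Nullary.Decidable using (⌊_⌋)

Rel : ℕ → Set
Rel n = Fin n → Fin n → Bool

record Graph (n : ℕ) : Set where
  field
    adj   : Rel n
    sym   : ∀ u v → adj u v ≡ adj v u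
    irref : ∀ u → adj u u ≡ false
open Graph public

countFin : {n : ℕ} → (Fin n → Bool) → ℕ
countFin {n} p = sum (map (λ x → if p x then 1 else 0) (allFin n))

deg : {n : ℕ} → Rel n → Fin n → ℕ
deg R u = countFin (R u)

Regular : {n : ℕ} → ℕ → Graph n → Set
Regular d G = ∀ u → deg (adj G) u ≡ d

SpanningSubgraph : {n : ℕ} → Graph n → Rel n → Set
SpanningSubgraph G R = (∀ u v → R u v ≡ R v u) × (∀ u v → T (R u v) → T (adj G u v))

PerfectMatching : {n : ℕ} → Graph n → Rel n → Set
PerfectMatching G M = SpanningSubgraph G M × (∀ u → deg M u ≡ 1)

minusEdges : {n : ℕ} → Graph n → Rel n → Rel n
minusEdges G M u v = adj G u v ∧ Data.Bool.not (M u v)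

TwoFactorOfMinus : {n : ℕ} → Graph n → Rel n → Rel n → Set
TwoFactorOfMinus G M F =
  (∀ u v → F u v ≡ F v u) × (∀ u v → T (F u v) → T (minusEdges G M u v)) × (∀ u → deg F u ≡ 2)

commonNbrs : {n : ℕ} → Graph n → Fin n → Fin n → ℕ
commonNbrs G u v = countFin (λ w → adj G u w ∧ adj G v w)

-- A copy of the double star S_{a,b} in K_n: an edge c₁c₂, a leaves attached to c₁,
-- b leaves attached to c₂, all a+b+2 vertices distinct.
record DoubleStarCopy (n : ℕ) : Set where
  field
    a b     : ℕ
    c₁ c₂   : Fin n
    leaves₁ : Vec (Fin n) a
    leaves₂ : Vec (Fin n) b
    distinct : Unique (c₁ ∷ c₂ ∷ (toList leaves₁ ++ toList leaves₂))
open DoubleStarCopy public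

-- edges of the copy, as (ordered representatives of) unordered pairs
edgesOf : {n : ℕ} → DoubleStarCopy n → List (Fin n × Fin n)
edgesOf S = (c₁ S , c₂ S) ∷ (map (λ x → (c₁ S , x)) (toList (leaves₁ S))
                             ++ map (λ y → (c₂ S , y)) (toList (leaves₂ S)))

hasEdge : {n : ℕ} → DoubleStarCopy n → Fin n → Fin n → Bool
hasEdge S x y = any (λ { (p , q) → (⌊ p ≟ x ⌋ ∧ ⌊ q ≟ y ⌋) ∨ (⌊ p ≟ y ⌋ ∧ ⌊ q ≟ x ⌋) }) (edgesOf S)

countList : {A : Set} → (A → Bool) → List A → ℕ
countList p xs = sum (map (λ x → if p x then 1 else 0) xs)

Decomposable2 : {n : ℕ} → Graph n → (ℕ × ℕ) → (ℕ × ℕ) → Set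
Decomposable2 {n} G (a₁ , b₁) (a₂ , b₂) =
  Data.Product.Σ (List (DoubleStarCopy n)) λ Ss →
    All (λ S → ((a S ≡ a₁) × (b S ≡ b₁)) ⊎ ((a S ≡ a₂) × (b S ≡ b₂))) Ss
    × All (λ S → All (λ { (p , q) → T (adj G p q) }) (edgesOf S)) Ss
    × (∀ x y → T (adj G x y) → countList (λ S → hasEdge S x y) Ss ≡ 1)

-- Deleting M and F from G leaves a 2(k − 1)-regular graph H. A loopless graph whose degrees are all
-- even has an orientation in which every out-degree is half the degree: split off two edges vw₁, vw₂
-- at a vertex v (toggling w₁w₂), orient the smaller graph by induction, and put v back on a directed
-- triangle or on the arc between w₁ and w₂. Orient F as directed cycles u → succ u and H with
-- out-degree k − 1 = k₁ + k₂. The star of u has centre edge u (succ u). Its leaves at succ u are k₂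
-- out-neighbours of succ u in H that are not adjacent to u; there are enough of them because u and
-- succ u have at most k₁ − 1 common neighbours. Its leaves at u are the k₁ out-neighbours of u not
-- taken by the star of pred u, plus the M-partner of u when u is the endpoint of smaller index.
-- Every F-edge is then a centre, every M-edge a leaf at its owner, and every arc t → w of H a leaf
-- of exactly one of the stars of t and pred t.

module Submission where

open import Defs hiding (sym)
import Data.Bool.Properties as 𝔹
import Data.Nat.Properties as ℕ
open import Algebra.Bundles using (CommutativeRing)
open import Algebra.Properties.CommutativeSemigroup ℕ.+-commutativeSemigroup
  using () renaming (interchange to +-interchange)
open import Algebra.Properties.CommutativeSemigroup (CommutativeRing.+-commutativeSemigroup 𝔹.xor-∧-commutativeRing)
  using () renaming (interchange to xor-interchange; xy∙z≈xz∙y to xor-swapʳ)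
open import Algebra.Properties.Monoid.Sum using (sum; sum-cong-≗)
open import Data.Bool using (Bool; true; false; _∧_; _∨_; not; _xor_; T; if_then_else_)
open import Data.Bool.Properties
  using (T-≡; ∧-comm; ∧-zeroʳ; ∧-identityʳ; ∨-zeroʳ; xor-assoc; xor-comm; xor-same; xor-identityʳ)
open import Data.Empty using (⊥; ⊥-elim)
open import Data.Fin using (Fin; zero; suc; _≟_; _<?_)
import Data.Fin as Fin
open import Data.Fin.Properties using (suc-injective; any?; <-cmp; <-asym)
open import Data.List using (List; _∷_; map; _++_; length; filter; tabulate; allFin)
open import Data.List.Membership.Propositional using (_∈_; find; lose)
open import Data.List.Membership.Propositional.Properties
  using (∈-filter⁻; ∈-filter⁺; ∈-allFin; ∈-map⁻; ∈-map⁺; ∈-++⁻; ∈-++⁺ˡ; ∈-++⁺ʳ)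
import Data.List.Relation.Unary.All as All
open import Data.List.Relation.Unary.All using (All; _∷_)
import Data.List.Relation.Unary.All.Properties as AllP
open import Data.List.Relation.Unary.AllPairs using (_∷_)
open import Data.List.Relation.Unary.Any using (here; there)
open import Data.List.Relation.Unary.Any.Properties using (any⁺; any⁻)
open import Data.List.Relation.Unary.Unique.Propositional using (Unique)
import Data.List.Relation.Unary.Unique.Propositional.Properties as UniqueP
open import Data.Nat using (ℕ; zero; suc; _+_; _*_; _∸_; _≤_; _<_; z≤n; s≤s; s≤s⁻¹)
open import Data.Nat.Properties
  using ( +-0-monoid; +-comm; +-assoc; +-identityʳ; +-cancelˡ-≡; +-cancelʳ-≡; +-cancelˡ-≤
        ; +-mono-≤; +-monoˡ-≤; +-mono-<; +-mono-<-≤; +-mono-≤-<; ≤-trans; ≮⇒≥; <⇒≱; _≤?_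
        ; m≤n+m; m∸n+n≡m; m∸n≤m; ∸-monoʳ-<; n≤0⇒n≡0 )
open import Data.Nat.Induction using (<-wellFounded)
open import Data.Nat.Tactic.RingSolver using (solve-∀)
open import Data.Product using (Σ; _×_; _,_; proj₁; proj₂)
open import Data.Sum using (_⊎_; inj₁; inj₂)
open import Data.Vec using (Vec; toList; fromList; cast)
open import Data.Vec.Properties using (toList-cast; toList∘fromList)
open import Function using (_∘_; Equivalence)
open import Induction.WellFounded using (Acc; acc)
open import Relation.Binary using (tri<; tri≈; tri>)
open import Relation.Binary.PropositionalEquality
open import Relation.Nullary using (Dec; yes; no; ¬_)
open import Relation.Nullary.Decidable using (⌊_⌋; ⌊⌋-map′; dec-true; dec-false; isYes≗does; T?)

private
  variable
    n : ℕ

∧-true : ∀ {a b} → a ∧ b ≡ true → a ≡ true × b ≡ true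
∧-true {true} {true} _ = refl , refl

not-true : ∀ {a} → not a ≡ true → a ≡ false
not-true {false} _ = refl

∨-true : ∀ {a b} → a ∨ b ≡ true → a ≡ true ⊎ b ≡ true
∨-true {true}  _  = inj₁ refl
∨-true {false} eq = inj₂ eq

indicator : Bool → ℕ
indicator b = if b then 1 else 0

total : (Fin n → ℕ) → ℕ
total = sum +-0-monoid

count : (Fin n → Bool) → ℕ
count p = total (indicator ∘ p)

countList-tabulate : {A : Set} (p : A → Bool) (g : Fin n → A) →
  countList p (tabulate g) ≡ count (p ∘ g)
countList-tabulate {zero} p g = refl
countList-tabulate {suc n} p g = cong (indicator (p (g zero)) +_) (countList-tabulate p (g ∘ suc))

countFin≡count : (p : Fin n → Bool) → countFin p ≡ count p
countFin≡count p = countList-tabulate p (λ x → x)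

count-cong : {p q : Fin n → Bool} → (∀ x → p x ≡ q x) → count p ≡ count q
count-cong p≗q = sum-cong-≗ +-0-monoid (cong indicator ∘ p≗q)

count-false : count {n} (λ _ → false) ≡ 0
count-false {zero} = refl
count-false {suc n} = count-false {n}

count-∨ : {p q : Fin n → Bool} → (∀ x → p x ∧ q x ≡ false) →
  count (λ x → p x ∨ q x) ≡ count p + count q
count-∨ {zero} disjoint = refl
count-∨ {suc n} {p} {q} disjoint =
  trans (cong₂ _+_ (head (p zero) (q zero) (disjoint zero)) (count-∨ (disjoint ∘ suc)))
        (+-interchange (indicator (p zero)) (indicator (q zero)) _ _)
  where
  head : ∀ a b → a ∧ b ≡ false → indicator (a ∨ b) ≡ indicator a + indicator b
  head true false _ = refl
  head false b _ = refl

count-partition : (p q : Fin n → Bool) →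
  count p ≡ count (λ x → p x ∧ q x) + count (λ x → p x ∧ not (q x))
count-partition p q = trans (count-cong (λ x → split (p x) (q x))) (count-∨ (λ x → disjoint (p x) (q x)))
  where
  split : ∀ a b → a ≡ (a ∧ b) ∨ (a ∧ not b)
  split true true = refl
  split true false = refl
  split false b = refl
  disjoint : ∀ a b → (a ∧ b) ∧ (a ∧ not b) ≡ false
  disjoint true true = refl
  disjoint true false = refl
  disjoint false b = refl

count-mono : {p q : Fin n → Bool} → (∀ x → p x ≡ true → q x ≡ true) → count p ≤ count q
count-mono {zero} p⊆q = z≤n
count-mono {suc n} {p} {q} p⊆q = +-mono-≤ (head (p zero) (q zero) (p⊆q zero)) (count-mono (p⊆q ∘ suc))
  where
  head : ∀ a b → (a ≡ true → b ≡ true) → indicator a ≤ indicator b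
  head true b a⇒b rewrite a⇒b refl = s≤s z≤n
  head false b _ = z≤n

count≡0⇒false : {p : Fin n → Bool} → count p ≡ 0 → ∀ x → p x ≡ false
count≡0⇒false {suc n} {p} eq x with p zero in p0
count≡0⇒false {suc n} {p} eq zero    | false = p0
count≡0⇒false {suc n} {p} eq (suc x) | false = count≡0⇒false {n} {p ∘ suc} eq x

⌊⌋-true : {A : Set} (d : Dec A) → A → ⌊ d ⌋ ≡ true
⌊⌋-true d a = trans (isYes≗does d) (dec-true d a)

⌊⌋-false : {A : Set} (d : Dec A) → ¬ A → ⌊ d ⌋ ≡ false
⌊⌋-false d ¬a = trans (isYes≗does d) (dec-false d ¬a)

⌊⌋-witness : {A : Set} (d : Dec A) → ⌊ d ⌋ ≡ true → A
⌊⌋-witness (yes a) _ = a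

⌊suc≟suc⌋ : (x y : Fin n) → ⌊ suc x ≟ suc y ⌋ ≡ ⌊ x ≟ y ⌋
⌊suc≟suc⌋ x y = ⌊⌋-map′ (cong suc) suc-injective (x ≟ y)

count-≟ : (c : Fin n) → count (λ x → ⌊ x ≟ c ⌋) ≡ 1
count-≟ {suc n} zero = cong suc (count-false {n})
count-≟ {suc n} (suc c) = trans (count-cong (λ x → ⌊suc≟suc⌋ x c)) (count-≟ c)

count-xor-≟ : (p : Fin n → Bool) (c : Fin n) →
  count (λ x → p x xor ⌊ x ≟ c ⌋) + indicator (p c) ≡ count p + indicator (not (p c))
count-xor-≟ {suc n} p zero
  rewrite count-cong (λ x → xor-identityʳ (p (suc x))) with p zero
... | true  = trans (+-comm _ 1) (sym (+-identityʳ _))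
... | false = trans (+-identityʳ _) (+-comm 1 _)
count-xor-≟ {suc n} p (suc c) = begin
  indicator (p zero xor false) + C′ + indicator (p (suc c))
    ≡⟨ cong (λ b → indicator b + C′ + indicator (p (suc c))) (xor-identityʳ (p zero)) ⟩
  indicator (p zero) + C′ + indicator (p (suc c))
    ≡⟨ +-assoc (indicator (p zero)) C′ _ ⟩
  indicator (p zero) + (C′ + indicator (p (suc c)))
    ≡⟨ cong (indicator (p zero) +_) tail ⟩
  indicator (p zero) + (count (p ∘ suc) + indicator (not (p (suc c))))
    ≡⟨ sym (+-assoc (indicator (p zero)) _ _) ⟩
  count p + indicator (not (p (suc c))) ∎
  where
  open ≡-Reasoning
  C′ = count (λ x → p (suc x) xor ⌊ suc x ≟ suc c ⌋)
  tail : C′ + indicator (p (suc c)) ≡ count (p ∘ suc) + indicator (not (p (suc c)))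
  tail = trans (cong (_+ indicator (p (suc c))) (count-cong (λ x → cong (p (suc x) xor_) (⌊suc≟suc⌋ x c))))
               (count-xor-≟ (p ∘ suc) c)

count≡1⇒unique : {p : Fin n → Bool} → count p ≡ 1 →
  Σ (Fin n) λ x → p x ≡ true × (∀ y → p y ≡ true → y ≡ x)
count≡1⇒unique {suc n} {p} eq with p zero in p0
... | true = zero , p0 , only-zero
  where
  only-zero : ∀ y → p y ≡ true → y ≡ zero
  only-zero zero _ = refl
  only-zero (suc y) py with () ← trans (sym py) (count≡0⇒false {n} {p ∘ suc} (ℕ.suc-injective eq) y)
... | false with count≡1⇒unique {n} {p ∘ suc} eq
... | x , px , unique = suc x , px , only-suc
  where
  only-suc : ∀ y → p y ≡ true → y ≡ suc x
  only-suc zero py with () ← trans (sym py) p0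
  only-suc (suc y) py = cong suc (unique y py)

unique⇒count≡1 : {p : Fin n → Bool} (c : Fin n) → p c ≡ true → (∀ y → p y ≡ true → y ≡ c) → count p ≡ 1
unique⇒count≡1 {p = p} c pc unique = trans (count-cong p≗[c]) (count-≟ c)
  where
  p≗[c] : ∀ x → p x ≡ ⌊ x ≟ c ⌋
  p≗[c] x with x ≟ c | p x in px
  ... | yes refl | _     = trans (sym px) pc
  ... | no _     | false = refl
  ... | no x≢c   | true  = ⊥-elim (x≢c (unique x px))

2≤count⇒distinct : {p : Fin n → Bool} → 2 ≤ count p →
  Σ (Fin n) λ a → Σ (Fin n) λ b → a ≢ b × p a ≡ true × p b ≡ true
2≤count⇒distinct {suc n} {p} le with p zero in p0
... | true  = let b , pb = witness {n} {p ∘ suc} (s≤s⁻¹ le) in zero , suc b , (λ ()) , p0 , pb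
  where
  witness : ∀ {n} {p : Fin n → Bool} → 1 ≤ count p → Σ (Fin n) λ x → p x ≡ true
  witness {suc n} {p} le with p zero in p0
  ... | true  = zero , p0
  ... | false = let x , px = witness {n} {p ∘ suc} le in suc x , px
... | false with 2≤count⇒distinct {n} {p ∘ suc} le
... | a , b , a≢b , pa , pb = suc a , suc b , a≢b ∘ suc-injective , pa , pb

total-mono : {f g : Fin n → ℕ} → (∀ z → f z ≤ g z) → total f ≤ total g
total-mono {zero} _ = z≤n
total-mono {suc n} f≤g = +-mono-≤ (f≤g zero) (total-mono (f≤g ∘ suc))

total-mono-< : {f g : Fin n → ℕ} (v : Fin n) → (∀ z → f z ≤ g z) → f v < g v →
  total f < total g
total-mono-< {suc n} zero    f≤g fv<gv = +-mono-<-≤ fv<gv (total-mono (f≤g ∘ suc))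
total-mono-< {suc n} (suc v) f≤g fv<gv = +-mono-≤-< (f≤g zero) (total-mono-< v (f≤g ∘ suc) fv<gv)

SymmetricRel : Rel n → Set
SymmetricRel R = ∀ x y → R x y ≡ R y x

Loopless : Rel n → Set
Loopless R = ∀ x → R x x ≡ false

outdeg : Rel n → Fin n → ℕ
outdeg D z = count (D z)

δ : Fin n → Fin n → ℕ
δ z a = indicator ⌊ z ≟ a ⌋

-- Under asymmetry xor agrees with ∨; with xor, toggling an edge of R is toggling one of its darts in D.
record IsOrientation (R D : Rel n) : Set where
  field
    underlying : ∀ x y → R x y ≡ D x y xor D y x
    asym       : ∀ x y → D x y ≡ true → D y x ≡ false
open IsOrientation

dart : Fin n → Fin n → Rel n
dart a b x y = ⌊ x ≟ a ⌋ ∧ ⌊ y ≟ b ⌋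

toggleDart : Rel n → Fin n → Fin n → Rel n
toggleDart D a b x y = D x y xor dart a b x y

edge : Fin n → Fin n → Rel n
edge a b x y = dart a b x y xor dart a b y x

toggleEdge : Rel n → Fin n → Fin n → Rel n
toggleEdge R a b x y = R x y xor edge a b x y

dart-refl : (a b : Fin n) → dart a b a b ≡ true
dart-refl a b rewrite ⌊⌋-true (a ≟ a) refl | ⌊⌋-true (b ≟ b) refl = refl

dart-≢ˡ : {a b x y : Fin n} → x ≢ a → dart a b x y ≡ false
dart-≢ˡ {a = a} {x = x} x≢a rewrite ⌊⌋-false (x ≟ a) x≢a = refl

dart-≢ʳ : {a b x y : Fin n} → y ≢ b → dart a b x y ≡ false
dart-≢ʳ {a = a} {b} {x} {y} y≢b rewrite ⌊⌋-false (y ≟ b) y≢b = ∧-zeroʳ ⌊ x ≟ a ⌋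

dart⇒≡ : (a b x y : Fin n) → dart a b x y ≡ true → x ≡ a × y ≡ b
dart⇒≡ a b x y eq = ⌊⌋-witness (x ≟ a) (proj₁ (∧-true eq)) , ⌊⌋-witness (y ≟ b) (proj₂ (∧-true eq))

xor-cancelʳ : ∀ x y → (x xor y) xor y ≡ x
xor-cancelʳ x y = trans (xor-assoc x y y) (trans (cong (x xor_) (xor-same y)) (xor-identityʳ x))

module _ {R D : Rel n} (o : IsOrientation R D) where

  orientation-absent : ∀ {x y} → R x y ≡ false → D x y ≡ false × D y x ≡ false
  orientation-absent {x} {y} Rxy with D x y in Dxy | D y x in Dyx
  ... | false | false = refl , refl
  ... | true  | _     with () ← trans (sym Rxy) (trans (underlying o x y) (cong₂ _xor_ Dxy (asym o x y Dxy)))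
  ... | false | true  with () ← trans (sym Rxy) (trans (underlying o x y) (cong₂ _xor_ Dxy Dyx))

  orientation-present : ∀ {x y} → R x y ≡ true → D x y ≡ true ⊎ D y x ≡ true
  orientation-present {x} {y} Rxy with D x y in Dxy | D y x in Dyx
  ... | true  | _     = inj₁ refl
  ... | false | true  = inj₂ refl
  ... | false | false with () ← trans (sym Rxy) (trans (underlying o x y) (cong₂ _xor_ Dxy Dyx))

  orientation-⊆ : ∀ {x y} → D x y ≡ true → R x y ≡ true
  orientation-⊆ {x} {y} Dxy = trans (underlying o x y) (cong₂ _xor_ Dxy (asym o x y Dxy))

  orientation-toggle : ∀ {a b} → a ≢ b → D b a ≡ false → IsOrientation (toggleEdge R a b) (toggleDart D a b)
  orientation-toggle {a} {b} a≢b Dba = record { underlying = underlying′ ; asym = asym′ }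
    where
    underlying′ : ∀ x y → toggleEdge R a b x y ≡ toggleDart D a b x y xor toggleDart D a b y x
    underlying′ x y = trans (cong (_xor edge a b x y) (underlying o x y))
                            (xor-interchange (D x y) (D y x) (dart a b x y) (dart a b y x))
    asym′ : ∀ x y → toggleDart D a b x y ≡ true → toggleDart D a b y x ≡ false
    asym′ x y D′xy with dart a b x y in dxy
    ... | true with refl , refl ← dart⇒≡ a b x y dxy = cong₂ _xor_ Dba (dart-≢ˡ (≢-sym a≢b))
    ... | false with dart a b y x in dyx
    ...   | false = trans (xor-identityʳ _) (asym o x y (trans (sym (xor-identityʳ _)) D′xy))
    ...   | true with refl , refl ← dart⇒≡ a b y x dyx with () ← trans (sym D′xy) (cong (_xor false) Dba)

  orientation-antisym : ∀ {x y} → D x y ≡ true → D y x ≡ true → ⊥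
  orientation-antisym {x} {y} Dxy Dyx with () ← trans (sym Dyx) (asym o x y Dxy)

orientation-cong : {R R′ D : Rel n} → (∀ x y → R x y ≡ R′ x y) → IsOrientation R D → IsOrientation R′ D
orientation-cong R≗R′ o = record
  { underlying = λ x y → trans (sym (R≗R′ x y)) (underlying o x y) ; asym = asym o }

module _ (D : Rel n) (a b : Fin n) where

  outdeg-toggle-absent : D a b ≡ false → ∀ z → outdeg (toggleDart D a b) z ≡ outdeg D z + δ z a
  outdeg-toggle-absent Dab z with z ≟ a
  ... | yes refl = begin
    count row                           ≡⟨ sym (+-identityʳ _) ⟩
    count row + indicator false         ≡⟨ cong (λ t → count row + indicator t) (sym Dab) ⟩
    count row + indicator (D z b)       ≡⟨ count-xor-≟ (D z) b ⟩
    outdeg D z + indicator (not (D z b)) ≡⟨ cong (λ t → outdeg D z + indicator (not t)) Dab ⟩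
    outdeg D z + 1                      ∎
    where
    open ≡-Reasoning
    row = λ y → D z y xor ⌊ y ≟ b ⌋
  ... | no z≢a = trans (count-cong (xor-identityʳ ∘ D z)) (sym (+-identityʳ _))

  outdeg-toggle-present : D a b ≡ true → ∀ z → outdeg (toggleDart D a b) z + δ z a ≡ outdeg D z
  outdeg-toggle-present Dab z with z ≟ a
  ... | yes refl = begin
    count row + 1                        ≡⟨ cong (λ t → count row + indicator t) (sym Dab) ⟩
    count row + indicator (D z b)        ≡⟨ count-xor-≟ (D z) b ⟩
    outdeg D z + indicator (not (D z b)) ≡⟨ cong (λ t → outdeg D z + indicator (not t)) Dab ⟩
    outdeg D z + 0                       ≡⟨ +-identityʳ _ ⟩
    outdeg D z                           ∎
    where
    open ≡-Reasoning
    row = λ y → D z y xor ⌊ y ≟ b ⌋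
  ... | no z≢a = trans (+-identityʳ _) (count-cong (xor-identityʳ ∘ D z))

toggleEdge-as-darts : (R : Rel n) (a b : Fin n) → ∀ x y → toggleEdge R a b x y ≡ toggleDart (toggleDart R a b) b a x y
toggleEdge-as-darts R a b x y =
  trans (cong (λ t → R x y xor (dart a b x y xor t)) (∧-comm ⌊ y ≟ a ⌋ ⌊ x ≟ b ⌋))
        (sym (xor-assoc (R x y) (dart a b x y) (dart b a x y)))

module _ {R : Rel n} (sym-R : SymmetricRel R) {a b : Fin n} (a≢b : a ≢ b) where

  private
    toggled-back : toggleDart R a b b a ≡ R a b
    toggled-back = trans (cong (R b a xor_) (dart-≢ˡ (≢-sym a≢b))) (trans (xor-identityʳ _) (sym-R b a))

  deg-toggleEdge-present : R a b ≡ true → ∀ z → outdeg (toggleEdge R a b) z + (δ z a + δ z b) ≡ outdeg R z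
  deg-toggleEdge-present Rab z = begin
    outdeg (toggleEdge R a b) z + (δ z a + δ z b)
      ≡⟨ cong (_+ _) (count-cong (toggleEdge-as-darts R a b z)) ⟩
    outdeg R″ z + (δ z a + δ z b)   ≡⟨ cong (outdeg R″ z +_) (+-comm (δ z a) (δ z b)) ⟩
    outdeg R″ z + (δ z b + δ z a)   ≡⟨ sym (+-assoc (outdeg R″ z) _ _) ⟩
    outdeg R″ z + δ z b + δ z a     ≡⟨ cong (_+ δ z a) (outdeg-toggle-present R′ b a (trans toggled-back Rab) z) ⟩
    outdeg R′ z + δ z a             ≡⟨ outdeg-toggle-present R a b Rab z ⟩
    outdeg R z                      ∎
    where
    open ≡-Reasoning
    R′ = toggleDart R a b
    R″ = toggleDart R′ b a

  deg-toggleEdge-absent : R a b ≡ false → ∀ z → outdeg (toggleEdge R a b) z ≡ outdeg R z + (δ z a + δ z b)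
  deg-toggleEdge-absent Rab z = begin
    outdeg (toggleEdge R a b) z  ≡⟨ count-cong (toggleEdge-as-darts R a b z) ⟩
    outdeg R″ z                  ≡⟨ outdeg-toggle-absent R′ b a (trans toggled-back Rab) z ⟩
    outdeg R′ z + δ z b          ≡⟨ cong (_+ δ z b) (outdeg-toggle-absent R a b Rab z) ⟩
    outdeg R z + δ z a + δ z b   ≡⟨ +-assoc (outdeg R z) _ _ ⟩
    outdeg R z + (δ z a + δ z b) ∎
    where
    open ≡-Reasoning
    R′ = toggleDart R a b
    R″ = toggleDart R′ b a

toggleEdge-symmetric : {R : Rel n} → SymmetricRel R → (a b : Fin n) → SymmetricRel (toggleEdge R a b)
toggleEdge-symmetric sym-R a b x y = cong₂ _xor_ (sym-R x y) (xor-comm (dart a b x y) (dart a b y x))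

toggleEdge-loopless : {R : Rel n} → Loopless R → (a b : Fin n) → Loopless (toggleEdge R a b)
toggleEdge-loopless loopless a b x = cong₂ _xor_ (loopless x) (xor-same (dart a b x x))

toggleEdge-flips : (R : Rel n) {a b : Fin n} → a ≢ b → toggleEdge R a b a b ≡ not (R a b)
toggleEdge-flips R {a} {b} a≢b =
  trans (cong₂ (λ s t → R a b xor (s xor t)) (dart-refl a b) (dart-≢ˡ (≢-sym a≢b))) (xor-comm (R a b) true)

toggleEdge-apartˡ : (R : Rel n) {a b x y : Fin n} → x ≢ a → x ≢ b → toggleEdge R a b x y ≡ R x y
toggleEdge-apartˡ R {a} {b} {x} {y} x≢a x≢b =
  trans (cong₂ (λ s t → R x y xor (s xor t)) (dart-≢ˡ {b = b} {y = y} x≢a) (dart-≢ʳ {a = a} {x = y} x≢b))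
        (xor-identityʳ _)

toggleEdge-apartʳ : (R : Rel n) {a b x y : Fin n} → y ≢ a → y ≢ b → toggleEdge R a b x y ≡ R x y
toggleEdge-apartʳ R {a} {b} {x} {y} y≢a y≢b =
  trans (cong₂ (λ s t → R x y xor (s xor t)) (dart-≢ʳ {a = a} {x = x} y≢b) (dart-≢ˡ {b = b} {y = x} y≢a))
        (xor-identityʳ _)

edge-swap : (a b x y : Fin n) → edge a b x y ≡ edge b a x y
edge-swap a b x y = trans (xor-comm (dart a b x y) (dart a b y x))
                          (cong₂ _xor_ (∧-comm ⌊ y ≟ a ⌋ ⌊ x ≟ b ⌋) (∧-comm ⌊ x ≟ a ⌋ ⌊ y ≟ b ⌋))

module _ {R D : Rel n} (o : IsOrientation R D) where

  lift-triangle : {a b c : Fin n} → a ≢ b → b ≢ c → c ≢ a →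
    R a b ≡ false → R b c ≡ false → R c a ≡ false →
    Σ (Rel n) λ D₊ → IsOrientation (toggleEdge (toggleEdge (toggleEdge R a b) b c) c a) D₊
                   × (∀ z → outdeg D₊ z ≡ outdeg D z + (δ z a + δ z b + δ z c))
  lift-triangle {a} {b} {c} a≢b b≢c c≢a Rab Rbc Rca = D₃ , o₃ , outdeg-D₃
    where
    R₁ = toggleEdge R a b
    D₁ = toggleDart D a b
    D₂ = toggleDart D₁ b c
    D₃ = toggleDart D₂ c a
    D-ab = orientation-absent o Rab
    o₁ = orientation-toggle o a≢b (proj₂ D-ab)
    D₁-bc = orientation-absent o₁ (trans (toggleEdge-apartʳ R c≢a (≢-sym b≢c)) Rbc)
    o₂ = orientation-toggle o₁ b≢c (proj₂ D₁-bc)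
    D₂-ca = orientation-absent o₂
      (trans (toggleEdge-apartʳ R₁ a≢b (≢-sym c≢a)) (trans (toggleEdge-apartˡ R c≢a (≢-sym b≢c)) Rca))
    o₃ = orientation-toggle o₂ c≢a (proj₂ D₂-ca)
    outdeg-D₃ : ∀ z → outdeg D₃ z ≡ outdeg D z + (δ z a + δ z b + δ z c)
    outdeg-D₃ z = begin
      outdeg D₃ z                        ≡⟨ outdeg-toggle-absent D₂ c a (proj₁ D₂-ca) z ⟩
      outdeg D₂ z + δ z c                ≡⟨ cong (_+ δ z c) (outdeg-toggle-absent D₁ b c (proj₁ D₁-bc) z) ⟩
      outdeg D₁ z + δ z b + δ z c        ≡⟨ cong (λ t → t + δ z b + δ z c) (outdeg-toggle-absent D a b (proj₁ D-ab) z) ⟩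
      outdeg D z + δ z a + δ z b + δ z c ≡⟨ cong (_+ δ z c) (+-assoc (outdeg D z) _ _) ⟩
      outdeg D z + (δ z a + δ z b) + δ z c ≡⟨ +-assoc (outdeg D z) _ _ ⟩
      outdeg D z + (δ z a + δ z b + δ z c) ∎
      where open ≡-Reasoning

  lift-path : {a b v : Fin n} → a ≢ b → v ≢ a → v ≢ b →
    D a b ≡ true → R a v ≡ false → R v b ≡ false →
    Σ (Rel n) λ D₊ → IsOrientation (toggleEdge (toggleEdge (toggleEdge R a b) a v) v b) D₊
                   × (∀ z → outdeg D₊ z ≡ outdeg D z + δ z v)
  lift-path {a} {b} {v} a≢b v≢a v≢b Dab Rav Rvb = D₃ , o₃ , outdeg-D₃
    where
    R₁ = toggleEdge R a b
    D₁ = toggleDart D a b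
    D₂ = toggleDart D₁ a v
    D₃ = toggleDart D₂ v b
    o₁ = orientation-toggle o a≢b (asym o a b Dab)
    D₁-av = orientation-absent o₁ (trans (toggleEdge-apartʳ R v≢a v≢b) Rav)
    o₂ = orientation-toggle o₁ (≢-sym v≢a) (proj₂ D₁-av)
    D₂-vb = orientation-absent o₂
      (trans (toggleEdge-apartʳ R₁ (≢-sym a≢b) (≢-sym v≢b)) (trans (toggleEdge-apartˡ R v≢a v≢b) Rvb))
    o₃ = orientation-toggle o₂ v≢b (proj₂ D₂-vb)
    outdeg-D₃ : ∀ z → outdeg D₃ z ≡ outdeg D z + δ z v
    outdeg-D₃ z = begin
      outdeg D₃ z                 ≡⟨ outdeg-toggle-absent D₂ v b (proj₁ D₂-vb) z ⟩
      outdeg D₂ z + δ z v         ≡⟨ cong (_+ δ z v) (outdeg-toggle-absent D₁ a v (proj₁ D₁-av) z) ⟩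
      outdeg D₁ z + δ z a + δ z v ≡⟨ cong (_+ δ z v) (outdeg-toggle-present D a b Dab z) ⟩
      outdeg D z + δ z v          ∎
      where open ≡-Reasoning

EvenDegrees : Rel n → (Fin n → ℕ) → Set
EvenDegrees R h = ∀ z → outdeg R z ≡ h z + h z

OrientationWithOutdeg : Rel n → (Fin n → ℕ) → Set
OrientationWithOutdeg {n} R h = Σ (Rel n) λ D → IsOrientation R D × (∀ z → outdeg D z ≡ h z)

OrientableBelow : (Fin n → ℕ) → Set
OrientableBelow {n} h = ∀ (R′ : Rel n) h′ → SymmetricRel R′ → Loopless R′ → EvenDegrees R′ h′ →
  total h′ < total h → OrientationWithOutdeg R′ h′

halve : ∀ {d s h} → d + (s + s) ≡ h + h → s ≤ h × d ≡ (h ∸ s) + (h ∸ s)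
halve {d} {s} {h} eq = s≤h , +-cancelʳ-≡ (s + s) d _ (trans eq (sym regroup))
  where
  s≤h : s ≤ h
  s≤h = ≮⇒≥ λ h<s → <⇒≱ (+-mono-< h<s h<s) (subst (s + s ≤_) eq (m≤n+m (s + s) d))
  regroup : (h ∸ s) + (h ∸ s) + (s + s) ≡ h + h
  regroup = trans (+-interchange (h ∸ s) (h ∸ s) s s) (cong₂ _+_ (m∸n+n≡m s≤h) (m∸n+n≡m s≤h))

module _ {R : Rel n} {h : Fin n → ℕ} (even : EvenDegrees R h)
         (IH : OrientableBelow h) where

  orient-reduced : {R′ : Rel n} → SymmetricRel R′ → Loopless R′ → (S : Fin n → ℕ) (v : Fin n) → 1 ≤ S v →
    (∀ z → outdeg R′ z + (S z + S z) ≡ outdeg R z) →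
    Σ (Rel n) λ D′ → IsOrientation R′ D′ × (∀ z → outdeg D′ z + S z ≡ h z)
  orient-reduced {R′} sym-R′ loopless-R′ S v 1≤Sv deg-R′ =
    D′ , o′ , λ z → trans (cong (_+ S z) (out-D′ z)) (m∸n+n≡m (proj₁ (halved z)))
    where
    halved : ∀ z → S z ≤ h z × outdeg R′ z ≡ (h z ∸ S z) + (h z ∸ S z)
    halved z = halve (trans (deg-R′ z) (even z))
    h′ : Fin n → ℕ
    h′ z = h z ∸ S z
    smaller : total h′ < total h
    smaller = total-mono-< v (λ z → m∸n≤m (h z) (S z)) (∸-monoʳ-< 1≤Sv (proj₁ (halved v)))
    oriented = IH R′ h′ sym-R′ loopless-R′ (proj₂ ∘ halved) smaller
    D′ = proj₁ oriented
    o′ = proj₁ (proj₂ oriented)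
    out-D′ = proj₂ (proj₂ oriented)

module _ (R : Rel n) (v w₁ w₂ : Fin n) (x y : Fin n) where

  private
    R′ = toggleEdge (toggleEdge (toggleEdge R v w₁) v w₂) w₁ w₂
    cancel₃ : ∀ r a b c → (((((r xor a) xor b) xor c) xor c) xor b) xor a ≡ r
    cancel₃ r a b c = trans (cong (λ t → (t xor b) xor a) (xor-cancelʳ ((r xor a) xor b) c))
                            (trans (cong (_xor a) (xor-cancelʳ (r xor a) b)) (xor-cancelʳ r a))

  restore-triangle : toggleEdge (toggleEdge (toggleEdge R′ w₁ w₂) w₂ v) v w₁ x y ≡ R x y
  restore-triangle = trans (cong (λ t → ((R′ x y xor edge w₁ w₂ x y) xor t) xor edge v w₁ x y) (edge-swap w₂ v x y))
                           (cancel₃ (R x y) (edge v w₁ x y) (edge v w₂ x y) (edge w₁ w₂ x y))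

  restore-path₂₁ : toggleEdge (toggleEdge (toggleEdge R′ w₂ w₁) w₂ v) v w₁ x y ≡ R x y
  restore-path₂₁ = trans (cong₂ (λ s t → ((R′ x y xor s) xor t) xor edge v w₁ x y)
                                (edge-swap w₂ w₁ x y) (edge-swap w₂ v x y))
                         (cancel₃ (R x y) (edge v w₁ x y) (edge v w₂ x y) (edge w₁ w₂ x y))

  restore-path₁₂ : toggleEdge (toggleEdge (toggleEdge R′ w₁ w₂) w₁ v) v w₂ x y ≡ R x y
  restore-path₁₂ = begin
    ((R′ x y xor e₃) xor edge w₁ v x y) xor e₂ ≡⟨ cong (λ t → ((R′ x y xor e₃) xor t) xor e₂) (edge-swap w₁ v x y) ⟩
    (((R₂ xor e₃) xor e₃) xor e₁) xor e₂     ≡⟨ cong (λ t → (t xor e₁) xor e₂) (xor-cancelʳ R₂ e₃) ⟩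
    (((R x y xor e₁) xor e₂) xor e₁) xor e₂  ≡⟨ cong (_xor e₂) (xor-swapʳ (R x y xor e₁) e₂ e₁) ⟩
    (((R x y xor e₁) xor e₁) xor e₂) xor e₂  ≡⟨ cong (_xor e₂) (cong (_xor e₂) (xor-cancelʳ (R x y) e₁)) ⟩
    (R x y xor e₂) xor e₂                    ≡⟨ xor-cancelʳ (R x y) e₂ ⟩
    R x y                                    ∎
    where
    open ≡-Reasoning
    e₁ = edge v w₁ x y
    e₂ = edge v w₂ x y
    e₃ = edge w₁ w₂ x y
    R₂ = (R x y xor e₁) xor e₂

-- Splitting off at v: R′ deletes vw₁ and vw₂ and toggles w₁w₂. An orientation of R′ is lifted by the
-- directed triangle w₁ → w₂ → v → w₁ if w₁w₂ ∈ R, and otherwise by rerouting the arc between w₁ and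
-- w₂ through v.
module _ {R : Rel n} {h : Fin n → ℕ} (sym-R : SymmetricRel R) (loopless-R : Loopless R) (even : EvenDegrees R h)
         (IH : OrientableBelow h)
         {v w₁ w₂ : Fin n} (w₁≢w₂ : w₁ ≢ w₂) (Rvw₁ : R v w₁ ≡ true) (Rvw₂ : R v w₂ ≡ true) where

  private
    adjacent⇒≢ : ∀ {x y} → R x y ≡ true → x ≢ y
    adjacent⇒≢ {x} Rxy refl with () ← trans (sym Rxy) (loopless-R x)

    v≢w₁ = adjacent⇒≢ Rvw₁
    v≢w₂ = adjacent⇒≢ Rvw₂
    R₁ = toggleEdge R v w₁
    R₂ = toggleEdge R₁ v w₂
    R′ = toggleEdge R₂ w₁ w₂
    sym-R₁ : SymmetricRel R₁
    sym-R₁ = toggleEdge-symmetric sym-R v w₁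
    sym-R₂ : SymmetricRel R₂
    sym-R₂ = toggleEdge-symmetric sym-R₁ v w₂
    sym-R′ : SymmetricRel R′
    sym-R′ = toggleEdge-symmetric sym-R₂ w₁ w₂
    loopless-R′ : Loopless R′
    loopless-R′ = toggleEdge-loopless {R = R₂}
                    (toggleEdge-loopless {R = R₁} (toggleEdge-loopless {R = R} loopless-R v w₁) v w₂) w₁ w₂

    R₁vw₂ : R₁ v w₂ ≡ true
    R₁vw₂ = trans (toggleEdge-apartʳ R (≢-sym v≢w₂) (≢-sym w₁≢w₂)) Rvw₂
    R₂w₁w₂ : R₂ w₁ w₂ ≡ R w₁ w₂
    R₂w₁w₂ = trans (toggleEdge-apartˡ R₁ (≢-sym v≢w₁) w₁≢w₂)
                   (toggleEdge-apartʳ R (≢-sym v≢w₂) (≢-sym w₁≢w₂))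
    R′w₂v : R′ w₂ v ≡ false
    R′w₂v = trans (toggleEdge-apartʳ R₂ v≢w₁ v≢w₂)
                  (trans (sym-R₂ w₂ v) (trans (toggleEdge-flips R₁ v≢w₂) (cong not R₁vw₂)))
    R′vw₁ : R′ v w₁ ≡ false
    R′vw₁ = trans (toggleEdge-apartˡ R₂ v≢w₁ v≢w₂)
                  (trans (toggleEdge-apartʳ R₁ (≢-sym v≢w₁) w₁≢w₂) (trans (toggleEdge-flips R v≢w₁) (cong not Rvw₁)))

    deg-R₂ : ∀ z → outdeg R₂ z + (δ z v + δ z w₂) + (δ z v + δ z w₁) ≡ outdeg R z
    deg-R₂ z = trans (cong (_+ (δ z v + δ z w₁)) (deg-toggleEdge-present sym-R₁ v≢w₂ R₁vw₂ z))
                     (deg-toggleEdge-present sym-R v≢w₁ Rvw₁ z)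

    δv≥1 : ∀ s → 1 ≤ s + δ v v
    δv≥1 s rewrite ⌊⌋-true (v ≟ v) refl = m≤n+m 1 s

  orient-splitting-triangle : R w₁ w₂ ≡ true → OrientationWithOutdeg R h
  orient-splitting-triangle Rw₁w₂ =
    D₊ , orientation-cong (restore-triangle R v w₁ w₂) o₊ , λ z → trans (out-D₊ z) (out-D′ z)
    where
    S = λ z → δ z w₁ + δ z w₂ + δ z v
    regroup : ∀ r a b c → r + ((b + c + a) + (b + c + a)) ≡ r + (b + c) + (a + c) + (a + b)
    regroup = solve-∀
    deg-R′ : ∀ z → outdeg R′ z + (S z + S z) ≡ outdeg R z
    deg-R′ z = trans (regroup (outdeg R′ z) (δ z v) (δ z w₁) (δ z w₂))
      (trans (cong (λ t → t + (δ z v + δ z w₂) + (δ z v + δ z w₁))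
                   (deg-toggleEdge-present sym-R₂ w₁≢w₂ (trans R₂w₁w₂ Rw₁w₂) z))
             (deg-R₂ z))
    reduced = orient-reduced even IH sym-R′ loopless-R′ S v (δv≥1 _) deg-R′
    o′ = proj₁ (proj₂ reduced)
    out-D′ = proj₂ (proj₂ reduced)
    R′w₁w₂ : R′ w₁ w₂ ≡ false
    R′w₁w₂ = trans (toggleEdge-flips R₂ w₁≢w₂) (cong not (trans R₂w₁w₂ Rw₁w₂))
    lifted = lift-triangle o′ w₁≢w₂ (≢-sym v≢w₂) v≢w₁ R′w₁w₂ R′w₂v R′vw₁
    D₊ = proj₁ lifted
    o₊ = proj₁ (proj₂ lifted)
    out-D₊ = proj₂ (proj₂ lifted)

  orient-splitting-path : R w₁ w₂ ≡ false → OrientationWithOutdeg R h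
  orient-splitting-path Rw₁w₂ = lift-either (orientation-present o′ R′w₁w₂)
    where
    regroup : ∀ r a b c → r + (b + c) + (a + a) ≡ r + (a + c) + (a + b)
    regroup = solve-∀
    deg-R′ : ∀ z → outdeg R′ z + (δ z v + δ z v) ≡ outdeg R z
    deg-R′ z = trans (cong (_+ (δ z v + δ z v)) (deg-toggleEdge-absent sym-R₂ w₁≢w₂ (trans R₂w₁w₂ Rw₁w₂) z))
                     (trans (regroup (outdeg R₂ z) (δ z v) (δ z w₁) (δ z w₂)) (deg-R₂ z))
    reduced = orient-reduced even IH sym-R′ loopless-R′ (λ z → δ z v) v (δv≥1 0) deg-R′
    o′ = proj₁ (proj₂ reduced)
    out-D′ = proj₂ (proj₂ reduced)
    R′w₁w₂ : R′ w₁ w₂ ≡ true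
    R′w₁w₂ = trans (toggleEdge-flips R₂ w₁≢w₂) (cong not (trans R₂w₁w₂ Rw₁w₂))
    finish : ∀ {R″} → (∀ x y → R″ x y ≡ R x y) →
             Σ (Rel n) (λ D₊ → IsOrientation R″ D₊ × (∀ z → outdeg D₊ z ≡ outdeg (proj₁ reduced) z + δ z v)) →
             OrientationWithOutdeg R h
    finish R″≗R (D₊ , o₊ , out-D₊) = D₊ , orientation-cong R″≗R o₊ , λ z → trans (out-D₊ z) (out-D′ z)
    lift-either : proj₁ reduced w₁ w₂ ≡ true ⊎ proj₁ reduced w₂ w₁ ≡ true → OrientationWithOutdeg R h
    lift-either (inj₁ D′w₁w₂) = finish (restore-path₁₂ R v w₁ w₂)
      (lift-path o′ w₁≢w₂ v≢w₁ v≢w₂ D′w₁w₂ (trans (sym-R′ w₁ v) R′vw₁) (trans (sym-R′ v w₂) R′w₂v))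
    lift-either (inj₂ D′w₂w₁) = finish (restore-path₂₁ R v w₁ w₂)
      (lift-path o′ (≢-sym w₁≢w₂) v≢w₂ v≢w₁ D′w₂w₁ R′w₂v R′vw₁)

  orient-by-splitting : OrientationWithOutdeg R h
  orient-by-splitting with R w₁ w₂ in Rw₁w₂
  ... | true  = orient-splitting-triangle Rw₁w₂
  ... | false = orient-splitting-path Rw₁w₂

orientation-with-outdeg : (R : Rel n) → SymmetricRel R → Loopless R → (h : Fin n → ℕ) → EvenDegrees R h →
  OrientationWithOutdeg R h
orientation-with-outdeg {n} R sym-R loopless-R h even = go R sym-R loopless-R h even (<-wellFounded _)
  where
  go : ∀ R → SymmetricRel R → Loopless R → (h : Fin n → ℕ) → EvenDegrees R h →
       Acc _<_ (total h) → OrientationWithOutdeg R h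
  go R sym-R loopless-R h even (acc smaller) with any? (λ v → 1 ≤? h v)
  ... | yes (v , 1≤hv) =
    let w₁ , w₂ , w₁≢w₂ , Rvw₁ , Rvw₂ = 2≤count⇒distinct (subst (2 ≤_) (sym (even v)) (+-mono-≤ 1≤hv 1≤hv))
    in orient-by-splitting sym-R loopless-R even IH w₁≢w₂ Rvw₁ Rvw₂
    where
    IH : OrientableBelow h
    IH R′ h′ s l e lt = go R′ s l h′ e (smaller lt)
  ... | no ∄v = (λ _ _ → false) , record { underlying = no-edges ; asym = λ _ _ () }
              , λ z → trans (count-false {n}) (sym (h≡0 z))
    where
    h≡0 : ∀ z → h z ≡ 0
    h≡0 z = n≤0⇒n≡0 (≮⇒≥ λ 0<hz → ∄v (z , 0<hz))
    no-edges : ∀ x y → R x y ≡ false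
    no-edges x = count≡0⇒false (trans (even x) (cong₂ _+_ (h≡0 x) (h≡0 x)))

indeg : Rel n → Fin n → ℕ
indeg D z = count (λ y → D y z)

outdeg+indeg : {R D : Rel n} → IsOrientation R D → ∀ z → outdeg R z ≡ outdeg D z + indeg D z
outdeg+indeg {D = D} o z = trans (count-cong (λ y → trans (underlying o z y) (xor≡∨ (D z y) (D y z) (asym o z y))))
                                  (count-∨ (λ y → disjoint (D z y) (D y z) (asym o z y)))
  where
  xor≡∨ : ∀ a b → (a ≡ true → b ≡ false) → a xor b ≡ a ∨ b
  xor≡∨ true  b a⇒¬b = cong not (a⇒¬b refl)
  xor≡∨ false b _    = refl
  disjoint : ∀ a b → (a ≡ true → b ≡ false) → a ∧ b ≡ false
  disjoint true  b a⇒¬b = a⇒¬b refl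
  disjoint false b _    = refl

elements : (Fin n → Bool) → List (Fin n)
elements p = filter (T? ∘ p) (allFin _)

∈-elements⁻ : {p : Fin n → Bool} {x : Fin n} → x ∈ elements p → p x ≡ true
∈-elements⁻ {n} {p} x∈ = Equivalence.to T-≡ (proj₂ (∈-filter⁻ (T? ∘ p) {xs = allFin n} x∈))

∈-elements⁺ : {p : Fin n → Bool} {x : Fin n} → p x ≡ true → x ∈ elements p
∈-elements⁺ {p = p} {x} px = ∈-filter⁺ (T? ∘ p) (∈-allFin x) (Equivalence.from T-≡ px)

elements-unique : (p : Fin n → Bool) → Unique (elements p)
elements-unique p = UniqueP.filter⁺ (T? ∘ p) (UniqueP.allFin⁺ _)

length-elements : (p : Fin n → Bool) → length (elements p) ≡ count p
length-elements p = length-filter-tabulate (λ x → x)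
  where
  length-filter-tabulate : ∀ {m} (g : Fin m → Fin _) → length (filter (T? ∘ p) (tabulate g)) ≡ count (p ∘ g)
  length-filter-tabulate {zero} g = refl
  length-filter-tabulate {suc m} g with p (g zero)
  ... | true  = cong suc (length-filter-tabulate (g ∘ suc))
  ... | false = length-filter-tabulate (g ∘ suc)

firstWhere : ℕ → (Fin n → Bool) → Fin n → Bool
firstWhere zero    p x       = false
firstWhere (suc k) p zero    = p zero
firstWhere (suc k) p (suc x) = firstWhere (if p zero then k else suc k) (p ∘ suc) x

firstWhere-⊆ : ∀ k (p : Fin n → Bool) x → firstWhere k p x ≡ true → p x ≡ true
firstWhere-⊆ (suc k) p zero    eq = eq
firstWhere-⊆ (suc k) p (suc x) eq = firstWhere-⊆ (if p zero then k else suc k) (p ∘ suc) x eq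

count-firstWhere : ∀ k (p : Fin n → Bool) → k ≤ count p → count (firstWhere k p) ≡ k
count-firstWhere {n} zero p _ = count-false {n}
count-firstWhere {suc n} (suc k) p k<count with p zero
... | true  = cong suc (count-firstWhere k (p ∘ suc) (s≤s⁻¹ k<count))
... | false = count-firstWhere (suc k) (p ∘ suc) k<count

toVec : {A : Set} {m : ℕ} (xs : List A) → length xs ≡ m → Vec A m
toVec xs eq = cast eq (fromList xs)

toList-toVec : {A : Set} {m : ℕ} (xs : List A) (eq : length xs ≡ m) → toList (toVec xs eq) ≡ xs
toList-toVec xs eq = trans (toList-cast eq (fromList xs)) (toList∘fromList xs)

SameEdge : Fin n × Fin n → Fin n → Fin n → Set
SameEdge (p , q) x y = (p ≡ x × q ≡ y) ⊎ (p ≡ y × q ≡ x)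

StarEdge : DoubleStarCopy n → Fin n → Fin n → Set
StarEdge {n} S x y =
  SameEdge (c₁ S , c₂ S) x y
  ⊎ (Σ (Fin n) λ w → w ∈ toList (leaves₁ S) × SameEdge (c₁ S , w) x y)
  ⊎ (Σ (Fin n) λ w → w ∈ toList (leaves₂ S) × SameEdge (c₂ S , w) x y)

module _ (S : DoubleStarCopy n) (x y : Fin n) where

  private
    isXY : Fin n → Fin n → Bool
    isXY p q = (⌊ p ≟ x ⌋ ∧ ⌊ q ≟ y ⌋) ∨ (⌊ p ≟ y ⌋ ∧ ⌊ q ≟ x ⌋)

    isXY⇒SameEdge : ∀ p q → isXY p q ≡ true → SameEdge (p , q) x y
    isXY⇒SameEdge p q eq with ⌊ p ≟ x ⌋ ∧ ⌊ q ≟ y ⌋ in pq≡xy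
    ... | true  = inj₁ (⌊⌋-witness (p ≟ x) (proj₁ (∧-true pq≡xy)) , ⌊⌋-witness (q ≟ y) (proj₂ (∧-true pq≡xy)))
    ... | false = inj₂ (⌊⌋-witness (p ≟ y) (proj₁ (∧-true eq)) , ⌊⌋-witness (q ≟ x) (proj₂ (∧-true eq)))

    SameEdge⇒isXY : ∀ p q → SameEdge (p , q) x y → isXY p q ≡ true
    SameEdge⇒isXY _ _ (inj₁ (refl , refl)) rewrite ⌊⌋-true (x ≟ x) refl | ⌊⌋-true (y ≟ y) refl = refl
    SameEdge⇒isXY _ _ (inj₂ (refl , refl)) rewrite ⌊⌋-true (x ≟ x) refl | ⌊⌋-true (y ≟ y) refl = ∨-zeroʳ _

    ∈-edgesOf⁻ : ∀ {e} → e ∈ edgesOf S → SameEdge e x y → StarEdge S x y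
    ∈-edgesOf⁻ (here refl) same = inj₁ same
    ∈-edgesOf⁻ (there e∈) same with ∈-++⁻ (map (c₁ S ,_) (toList (leaves₁ S))) e∈
    ... | inj₁ e∈₁ with w , w∈ , refl ← ∈-map⁻ (c₁ S ,_) e∈₁ = inj₂ (inj₁ (w , w∈ , same))
    ... | inj₂ e∈₂ with w , w∈ , refl ← ∈-map⁻ (c₂ S ,_) e∈₂ = inj₂ (inj₂ (w , w∈ , same))

    ∈-edgesOf⁺ : ∀ {p q} → (p , q) ∈ edgesOf S → SameEdge (p , q) x y → hasEdge S x y ≡ true
    ∈-edgesOf⁺ e∈ same = Equivalence.to T-≡ (any⁺ _ (lose e∈ (Equivalence.from T-≡ (SameEdge⇒isXY _ _ same))))

  hasEdge⇒StarEdge : hasEdge S x y ≡ true → StarEdge S x y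
  hasEdge⇒StarEdge eq with (p , q) , e∈ , t ← find (any⁻ _ (edgesOf S) (Equivalence.from T-≡ eq)) =
    ∈-edgesOf⁻ e∈ (isXY⇒SameEdge p q (Equivalence.to T-≡ t))

  StarEdge⇒hasEdge : StarEdge S x y → hasEdge S x y ≡ true
  StarEdge⇒hasEdge (inj₁ same) = ∈-edgesOf⁺ (here refl) same
  StarEdge⇒hasEdge (inj₂ (inj₁ (w , w∈ , same))) = ∈-edgesOf⁺ (there (∈-++⁺ˡ (∈-map⁺ (c₁ S ,_) w∈))) same
  StarEdge⇒hasEdge (inj₂ (inj₂ (w , w∈ , same))) =
    ∈-edgesOf⁺ (there (∈-++⁺ʳ (map (c₁ S ,_) (toList (leaves₁ S))) (∈-map⁺ (c₂ S ,_) w∈))) same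

SameEdge-rel : {R : Rel n} → SymmetricRel R → ∀ {a b x y} → SameEdge (a , b) x y → R a b ≡ true → R x y ≡ true
SameEdge-rel sym-R (inj₁ (refl , refl)) Rab = Rab
SameEdge-rel sym-R {a} {b} (inj₂ (refl , refl)) Rab = trans (sym-R b a) Rab

SameEdge-match : ∀ {a b c d x y : Fin n} → SameEdge (a , b) x y → SameEdge (c , d) x y →
  (a ≡ c × b ≡ d) ⊎ (a ≡ d × b ≡ c)
SameEdge-match (inj₁ (refl , refl)) (inj₁ (c≡a , d≡b)) = inj₁ (sym c≡a , sym d≡b)
SameEdge-match (inj₁ (refl , refl)) (inj₂ (c≡b , d≡a)) = inj₂ (sym d≡a , sym c≡b)
SameEdge-match (inj₂ (refl , refl)) (inj₁ (c≡b , d≡a)) = inj₂ (sym d≡a , sym c≡b)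
SameEdge-match (inj₂ (refl , refl)) (inj₂ (c≡a , d≡b)) = inj₁ (sym c≡a , sym d≡b)

module Construction (n k k₁ k₂ : ℕ) (G : Graph n) (M F : Rel n)
  (regular : Regular (2 * k + 1) G) (matching : PerfectMatching G M) (factor : TwoFactorOfMinus G M F)
  (k-split : k₁ + k₂ ≡ k ∸ 1)
  (few-common : ∀ u v → T (F u v) → commonNbrs G u v ≤ k₁ ∸ 1) where

  E : Rel n
  E = adj G

  H : Rel n
  H a b = (E a b ∧ not (M a b)) ∧ not (F a b)

  true≢false : ∀ {b} → b ≡ true → b ≡ false → ⊥
  true≢false refl ()

  E⇒≢ : ∀ {a b} → E a b ≡ true → a ≢ b
  E⇒≢ {a} Eab refl = true≢false Eab (irref G a)

  M⇒E : ∀ {a b} → M a b ≡ true → E a b ≡ true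
  M⇒E {a} {b} Mab = Equivalence.to T-≡ (proj₂ (proj₁ matching) a b (Equivalence.from T-≡ Mab))

  F⇒E∖M : ∀ {a b} → F a b ≡ true → E a b ∧ not (M a b) ≡ true
  F⇒E∖M {a} {b} Fab = Equivalence.to T-≡ (proj₁ (proj₂ factor) a b (Equivalence.from T-≡ Fab))

  F⇒E : ∀ {a b} → F a b ≡ true → E a b ≡ true
  F⇒E {a} {b} = proj₁ ∘ ∧-true {E a b} ∘ F⇒E∖M

  F⇒¬M : ∀ {a b} → F a b ≡ true → M a b ≡ false
  F⇒¬M {a} {b} Fab = not-true (proj₂ (∧-true {E a b} (F⇒E∖M Fab)))

  H⇒E : ∀ {a b} → H a b ≡ true → E a b ≡ true
  H⇒E {a} {b} = proj₁ ∘ ∧-true {E a b} ∘ proj₁ ∘ ∧-true {E a b ∧ not (M a b)}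

  H⇒¬M : ∀ {a b} → H a b ≡ true → M a b ≡ false
  H⇒¬M {a} {b} Hab = not-true (proj₂ (∧-true {E a b} (proj₁ (∧-true {E a b ∧ not (M a b)} Hab))))

  H⇒¬F : ∀ {a b} → H a b ≡ true → F a b ≡ false
  H⇒¬F {a} {b} Hab = not-true (proj₂ (∧-true {E a b ∧ not (M a b)} Hab))

  M-sym : SymmetricRel M
  M-sym = proj₁ (proj₁ matching)

  F-sym : SymmetricRel F
  F-sym = proj₁ factor

  H-sym : SymmetricRel H
  H-sym a b rewrite Graph.sym G a b | M-sym a b | F-sym a b = refl

  F-loopless : Loopless F
  F-loopless a with F a a in Faa
  ... | false = refl
  ... | true  = ⊥-elim (E⇒≢ (F⇒E Faa) refl)

  H-loopless : Loopless H
  H-loopless a rewrite irref G a = refl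

  E-partition : ∀ a b → E a b ≡ (M a b ∨ F a b) ∨ H a b
  E-partition a b = partition (E a b) (M a b) (F a b) M⇒E F⇒E∖M
    where
    partition : ∀ e m f → (m ≡ true → e ≡ true) → (f ≡ true → e ∧ not m ≡ true) →
                e ≡ (m ∨ f) ∨ ((e ∧ not m) ∧ not f)
    partition true  true  false _ _ = refl
    partition true  true  true  _ f⇒ with () ← f⇒ refl
    partition true  false f     _ _ = sym (𝔹.∨-inverseʳ f)
    partition false true  f m⇒ _ with () ← m⇒ refl
    partition false false true  _ f⇒ with () ← f⇒ refl
    partition false false false _ _ = refl

  M-deg : ∀ u → outdeg M u ≡ 1
  M-deg u = trans (sym (countFin≡count (M u))) (proj₂ matching u)

  F-deg : ∀ u → outdeg F u ≡ 1 + 1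
  F-deg u = trans (sym (countFin≡count (F u))) (proj₂ (proj₂ factor) u)

  H-deg : ∀ u → outdeg H u ≡ (k ∸ 1) + (k ∸ 1)
  H-deg u = halve-excess k (outdeg H u) (begin
    2 * k + 1                                      ≡⟨ sym (regular u) ⟩
    countFin (E u)                                 ≡⟨ countFin≡count (E u) ⟩
    outdeg E u                                     ≡⟨ count-cong (E-partition u) ⟩
    count (λ w → (M u w ∨ F u w) ∨ H u w)
      ≡⟨ count-∨ (λ w → MF-H-disjoint (M u w) (F u w) (H u w) H⇒¬M H⇒¬F) ⟩
    count (λ w → M u w ∨ F u w) + outdeg H u
      ≡⟨ cong (_+ outdeg H u) (count-∨ (λ w → M-F-disjoint (M u w) (F u w) F⇒¬M)) ⟩
    outdeg M u + outdeg F u + outdeg H u           ≡⟨ cong₂ (λ s t → s + t + outdeg H u) (M-deg u) (F-deg u) ⟩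
    3 + outdeg H u                                 ∎)
    where
    open ≡-Reasoning
    MF-H-disjoint : ∀ m f h → (h ≡ true → m ≡ false) → (h ≡ true → f ≡ false) → (m ∨ f) ∧ h ≡ false
    MF-H-disjoint m f false _ _ = ∧-zeroʳ (m ∨ f)
    MF-H-disjoint m f true h⇒¬m h⇒¬f rewrite h⇒¬m refl | h⇒¬f refl = refl
    M-F-disjoint : ∀ m f → (f ≡ true → m ≡ false) → m ∧ f ≡ false
    M-F-disjoint m false _ = ∧-zeroʳ m
    M-F-disjoint m true f⇒¬m = trans (∧-identityʳ m) (f⇒¬m refl)
    halve-excess : ∀ k d → 2 * k + 1 ≡ 3 + d → d ≡ (k ∸ 1) + (k ∸ 1)
    halve-excess zero d ()
    halve-excess (suc k) d eq = +-cancelˡ-≡ 3 d (k + k) (trans (sym eq) (regroup k))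
      where
      regroup : ∀ k → 2 * suc k + 1 ≡ 3 + (k + k)
      regroup = solve-∀

  -- Opaque, since unfolding the recursive orientation construction makes later type checking intractable.
  opaque
    F-oriented : OrientationWithOutdeg F (λ _ → 1)
    F-oriented = orientation-with-outdeg F F-sym F-loopless (λ _ → 1) F-deg

    H-oriented : OrientationWithOutdeg H (λ _ → k ∸ 1)
    H-oriented = orientation-with-outdeg H H-sym H-loopless (λ _ → k ∸ 1) H-deg

  F⃗ H⃗ : Rel n
  F⃗ = proj₁ F-oriented
  H⃗ = proj₁ H-oriented

  F⃗-orientation : IsOrientation F F⃗
  F⃗-orientation = proj₁ (proj₂ F-oriented)

  H⃗-orientation : IsOrientation H H⃗
  H⃗-orientation = proj₁ (proj₂ H-oriented)

  H⃗⇒H : ∀ {a b} → H⃗ a b ≡ true → H a b ≡ true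
  H⃗⇒H = orientation-⊆ H⃗-orientation

  H⃗-outdeg : ∀ u → outdeg H⃗ u ≡ k₁ + k₂
  H⃗-outdeg u = trans (proj₂ (proj₂ H-oriented) u) (sym k-split)

  F⃗-indeg : ∀ u → indeg F⃗ u ≡ 1
  F⃗-indeg u = +-cancelˡ-≡ 1 _ _ (begin
    1 + indeg F⃗ u             ≡⟨ cong (_+ indeg F⃗ u) (sym (proj₂ (proj₂ F-oriented) u)) ⟩
    outdeg F⃗ u + indeg F⃗ u   ≡⟨ sym (outdeg+indeg F⃗-orientation u) ⟩
    outdeg F u                ≡⟨ F-deg u ⟩
    1 + 1                     ∎)
    where open ≡-Reasoning

  private
    Unique-at : (Fin n → Bool) → Set
    Unique-at p = Σ (Fin n) λ x → p x ≡ true × (∀ y → p y ≡ true → y ≡ x)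
    successor : ∀ u → Unique-at (F⃗ u)
    successor u = count≡1⇒unique (proj₂ (proj₂ F-oriented) u)
    predecessor : ∀ u → Unique-at (λ y → F⃗ y u)
    predecessor u = count≡1⇒unique (F⃗-indeg u)
    partner : ∀ u → Unique-at (M u)
    partner u = count≡1⇒unique (M-deg u)

  succ pred mate : Fin n → Fin n
  succ = proj₁ ∘ successor
  pred = proj₁ ∘ predecessor
  mate = proj₁ ∘ partner

  F⃗-succ : ∀ u → F⃗ u (succ u) ≡ true
  F⃗-succ = proj₁ ∘ proj₂ ∘ successor

  F⃗-pred : ∀ u → F⃗ (pred u) u ≡ true
  F⃗-pred = proj₁ ∘ proj₂ ∘ predecessor

  M-mate : ∀ u → M u (mate u) ≡ true
  M-mate = proj₁ ∘ proj₂ ∘ partner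

  succ-unique : ∀ u {y} → F⃗ u y ≡ true → y ≡ succ u
  succ-unique u = proj₂ (proj₂ (successor u)) _

  mate-unique : ∀ u {y} → M u y ≡ true → y ≡ mate u
  mate-unique u = proj₂ (proj₂ (partner u)) _

  succ∘pred : ∀ u → succ (pred u) ≡ u
  succ∘pred u = sym (succ-unique (pred u) (F⃗-pred u))

  pred∘succ : ∀ u → pred (succ u) ≡ u
  pred∘succ u = sym (proj₂ (proj₂ (predecessor (succ u))) u (F⃗-succ u))

  mate∘mate : ∀ u → mate (mate u) ≡ u
  mate∘mate u = sym (mate-unique (mate u) (trans (M-sym (mate u) u) (M-mate u)))

  F-succ : ∀ u → F u (succ u) ≡ true
  F-succ u = orientation-⊆ F⃗-orientation (F⃗-succ u)

  owner : Fin n → Bool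
  owner u = ⌊ u <? mate u ⌋

  owner-unique : ∀ u → owner u ≡ true → owner (mate u) ≡ false
  owner-unique u own = ⌊⌋-false (mate u <? mate (mate u))
    λ lt → <-asym (⌊⌋-witness (u <? mate u) own) (subst (λ v → mate u Fin.< v) (mate∘mate u) lt)

  owner-exists : ∀ u → owner u ≡ false → owner (mate u) ≡ true
  owner-exists u ¬own with <-cmp u (mate u)
  ... | tri< lt _ _ = ⊥-elim (true≢false (⌊⌋-true (u <? mate u) lt) ¬own)
  ... | tri≈ _ eq _ = ⊥-elim (E⇒≢ (M⇒E (M-mate u)) eq)
  ... | tri> _ _ gt = ⌊⌋-true (mate u <? mate (mate u)) (subst (λ v → mate u Fin.< v) (sym (mate∘mate u)) gt)

  candidates : Fin n → Fin n → Bool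
  candidates u w = H⃗ (succ u) w ∧ not (E u w)

  k₂≤candidates : ∀ u → k₂ ≤ count (candidates u)
  k₂≤candidates u = +-cancelˡ-≤ k₁ k₂ _
    (subst (_≤ k₁ + count (candidates u)) (sym split) (+-monoˡ-≤ (count (candidates u)) shared≤k₁))
    where
    split : k₁ + k₂ ≡ count (λ w → H⃗ (succ u) w ∧ E u w) + count (candidates u)
    split = trans (sym (H⃗-outdeg (succ u))) (count-partition (H⃗ (succ u)) (E u))
    shared⊆common : ∀ w → H⃗ (succ u) w ∧ E u w ≡ true → E u w ∧ E (succ u) w ≡ true
    shared⊆common w eq with ∧-true {H⃗ (succ u) w} eq
    ... | H⃗w , Euw rewrite Euw = H⇒E (H⃗⇒H H⃗w)
    shared≤k₁ : count (λ w → H⃗ (succ u) w ∧ E u w) ≤ k₁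
    shared≤k₁ = ≤-trans (count-mono shared⊆common) (≤-trans common≤ (m∸n≤m k₁ 1))
      where
      common≤ : count (λ w → E u w ∧ E (succ u) w) ≤ k₁ ∸ 1
      common≤ = subst (_≤ k₁ ∸ 1) (countFin≡count (λ w → E u w ∧ E (succ u) w))
                      (few-common u (succ u) (Equivalence.from T-≡ (F-succ u)))

  leaf₂ : Fin n → Fin n → Bool
  leaf₂ u = firstWhere k₂ (candidates u)

  count-leaf₂ : ∀ u → count (leaf₂ u) ≡ k₂
  count-leaf₂ u = count-firstWhere k₂ (candidates u) (k₂≤candidates u)

  leaf₂⇒H⃗ : ∀ {u w} → leaf₂ u w ≡ true → H⃗ (succ u) w ≡ true
  leaf₂⇒H⃗ {u} {w} eq = proj₁ (∧-true {H⃗ (succ u) w} (firstWhere-⊆ k₂ (candidates u) w eq))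

  leaf₂⇒¬E : ∀ {u w} → leaf₂ u w ≡ true → E u w ≡ false
  leaf₂⇒¬E {u} {w} eq = not-true (proj₂ (∧-true {H⃗ (succ u) w} (firstWhere-⊆ k₂ (candidates u) w eq)))

  leaf₁ : Fin n → Fin n → Bool
  leaf₁ u w = (H⃗ u w ∧ not (leaf₂ (pred u) w)) ∨ (owner u ∧ ⌊ w ≟ mate u ⌋)

  arity : Fin n → ℕ
  arity u = if owner u then suc k₁ else k₁

  leaf₂-pred⇒H⃗ : ∀ {u w} → leaf₂ (pred u) w ≡ true → H⃗ u w ≡ true
  leaf₂-pred⇒H⃗ {u} {w} eq = subst (λ v → H⃗ v w ≡ true) (succ∘pred u) (leaf₂⇒H⃗ eq)

  matched⇒≡mate : ∀ {u w} → owner u ∧ ⌊ w ≟ mate u ⌋ ≡ true → w ≡ mate u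
  matched⇒≡mate {u} {w} eq = ⌊⌋-witness (w ≟ mate u) (proj₂ (∧-true {owner u} eq))

  leaf₁⇒E : ∀ {u w} → leaf₁ u w ≡ true → E u w ≡ true
  leaf₁⇒E {u} {w} eq with ∨-true {H⃗ u w ∧ not (leaf₂ (pred u) w)} eq
  ... | inj₁ unclaimed = H⇒E (H⃗⇒H (proj₁ (∧-true {H⃗ u w} unclaimed)))
  ... | inj₂ matched   = subst (λ v → E u v ≡ true) (sym (matched⇒≡mate matched)) (M⇒E (M-mate u))

  count-leaf₁ : ∀ u → count (leaf₁ u) ≡ arity u
  count-leaf₁ u = begin
    count (leaf₁ u)                    ≡⟨ count-∨ disjoint ⟩
    count unclaimed + count matched    ≡⟨ cong₂ _+_ count-unclaimed count-matched ⟩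
    k₁ + indicator (owner u)           ≡⟨ plus-indicator (owner u) ⟩
    arity u                            ∎
    where
    open ≡-Reasoning
    unclaimed = λ w → H⃗ u w ∧ not (leaf₂ (pred u) w)
    matched = λ w → owner u ∧ ⌊ w ≟ mate u ⌋
    disjoint : ∀ w → unclaimed w ∧ matched w ≡ false
    disjoint w with unclaimed w in un | matched w in ma
    ... | false | _     = refl
    ... | true  | false = refl
    ... | true  | true  = ⊥-elim (true≢false (subst (λ v → M u v ≡ true) (sym (matched⇒≡mate ma)) (M-mate u))
                                            (H⇒¬M (H⃗⇒H (proj₁ (∧-true {H⃗ u w} un)))))
    count-unclaimed : count unclaimed ≡ k₁
    count-unclaimed = +-cancelˡ-≡ k₂ _ _ (begin
      k₂ + count unclaimed                                          ≡⟨ cong (_+ count unclaimed) (sym (count-leaf₂ (pred u))) ⟩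
      count (leaf₂ (pred u)) + count unclaimed                     ≡⟨ cong (_+ count unclaimed) (count-cong claimed) ⟩
      count (λ w → H⃗ u w ∧ leaf₂ (pred u) w) + count unclaimed    ≡⟨ sym (count-partition (H⃗ u) (leaf₂ (pred u))) ⟩
      outdeg H⃗ u                                                   ≡⟨ H⃗-outdeg u ⟩
      k₁ + k₂                                                       ≡⟨ +-comm k₁ k₂ ⟩
      k₂ + k₁                                                       ∎)
      where
      claimed : ∀ w → leaf₂ (pred u) w ≡ H⃗ u w ∧ leaf₂ (pred u) w
      claimed w with leaf₂ (pred u) w in s
      ... | true  = sym (cong (_∧ true) (leaf₂-pred⇒H⃗ s))
      ... | false = sym (∧-zeroʳ (H⃗ u w))
    count-matched : count matched ≡ indicator (owner u)
    count-matched with owner u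
    ... | true  = count-≟ (mate u)
    ... | false = count-false {n}
    plus-indicator : ∀ b → k₁ + indicator b ≡ (if b then suc k₁ else k₁)
    plus-indicator true  = +-comm k₁ 1
    plus-indicator false = +-identityʳ k₁

  leaf₁⇒≢succ : ∀ {u w} → leaf₁ u w ≡ true → succ u ≢ w
  leaf₁⇒≢succ {u} {w} eq refl with ∨-true {H⃗ u w ∧ not (leaf₂ (pred u) w)} eq
  ... | inj₁ unclaimed = true≢false (F-succ u) (H⇒¬F (H⃗⇒H (proj₁ (∧-true {H⃗ u w} unclaimed))))
  ... | inj₂ matched = true≢false (subst (λ v → M u v ≡ true) (sym (matched⇒≡mate matched)) (M-mate u)) (F⇒¬M (F-succ u))

  leaf₂⇒≢ : ∀ {u w} → leaf₂ u w ≡ true → u ≢ w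
  leaf₂⇒≢ {u} eq refl = true≢false (trans (F-sym (succ u) u) (F-succ u)) (H⇒¬F (H⃗⇒H (leaf₂⇒H⃗ eq)))

  leaf₂⇒≢succ : ∀ {u w} → leaf₂ u w ≡ true → succ u ≢ w
  leaf₂⇒≢succ eq = E⇒≢ (H⇒E (H⃗⇒H (leaf₂⇒H⃗ eq)))

  star-distinct : ∀ u → Unique (u ∷ succ u ∷ (elements (leaf₁ u) ++ elements (leaf₂ u)))
  star-distinct u =
    (E⇒≢ (F⇒E (F-succ u)) ∷ All.tabulate (λ w∈ → leaf-cases {P = u ≢_} w∈ (E⇒≢ ∘ leaf₁⇒E) leaf₂⇒≢))
    ∷ All.tabulate (λ w∈ → leaf-cases {P = succ u ≢_} w∈ leaf₁⇒≢succ leaf₂⇒≢succ)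
    ∷ UniqueP.++⁺ (elements-unique (leaf₁ u)) (elements-unique (leaf₂ u))
        (λ (w∈₁ , w∈₂) → true≢false (leaf₁⇒E (∈-elements⁻ w∈₁)) (leaf₂⇒¬E (∈-elements⁻ w∈₂)))
    where
    leaf-cases : ∀ {w} {P : Fin n → Set} → w ∈ elements (leaf₁ u) ++ elements (leaf₂ u) →
                 (leaf₁ u w ≡ true → P w) → (leaf₂ u w ≡ true → P w) → P w
    leaf-cases w∈ on-leaf₁ on-leaf₂ with ∈-++⁻ (elements (leaf₁ u)) w∈
    ... | inj₁ w∈₁ = on-leaf₁ (∈-elements⁻ w∈₁)
    ... | inj₂ w∈₂ = on-leaf₂ (∈-elements⁻ w∈₂)

  length-leaf₁ : ∀ u → length (elements (leaf₁ u)) ≡ arity u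
  length-leaf₁ u = trans (length-elements (leaf₁ u)) (count-leaf₁ u)

  length-leaf₂ : ∀ u → length (elements (leaf₂ u)) ≡ k₂
  length-leaf₂ u = trans (length-elements (leaf₂ u)) (count-leaf₂ u)

  leafVec₁ : (u : Fin n) → Vec (Fin n) (arity u)
  leafVec₁ u = toVec (elements (leaf₁ u)) (length-leaf₁ u)

  leafVec₂ : (u : Fin n) → Vec (Fin n) k₂
  leafVec₂ u = toVec (elements (leaf₂ u)) (length-leaf₂ u)

  toList-leafVec₁ : ∀ u → toList (leafVec₁ u) ≡ elements (leaf₁ u)
  toList-leafVec₁ u = toList-toVec (elements (leaf₁ u)) (length-leaf₁ u)

  toList-leafVec₂ : ∀ u → toList (leafVec₂ u) ≡ elements (leaf₂ u)
  toList-leafVec₂ u = toList-toVec (elements (leaf₂ u)) (length-leaf₂ u)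

  star : Fin n → DoubleStarCopy n
  star u = record
    { a = arity u ; b = k₂ ; c₁ = u ; c₂ = succ u
    ; leaves₁ = leafVec₁ u ; leaves₂ = leafVec₂ u
    ; distinct = subst₂ (λ xs ys → Unique (u ∷ succ u ∷ (xs ++ ys)))
                        (sym (toList-leafVec₁ u)) (sym (toList-leafVec₂ u)) (star-distinct u)
    }

  ∈-leafVec₁ : ∀ {u w} → w ∈ toList (leafVec₁ u) → leaf₁ u w ≡ true
  ∈-leafVec₁ {u} w∈ = ∈-elements⁻ (subst (_ ∈_) (toList-leafVec₁ u) w∈)

  ∈-leafVec₂ : ∀ {u w} → w ∈ toList (leafVec₂ u) → leaf₂ u w ≡ true
  ∈-leafVec₂ {u} w∈ = ∈-elements⁻ (subst (_ ∈_) (toList-leafVec₂ u) w∈)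

  leafVec₁-∋ : ∀ {u w} → leaf₁ u w ≡ true → w ∈ toList (leafVec₁ u)
  leafVec₁-∋ {u} eq = subst (_ ∈_) (sym (toList-leafVec₁ u)) (∈-elements⁺ eq)

  leafVec₂-∋ : ∀ {u w} → leaf₂ u w ≡ true → w ∈ toList (leafVec₂ u)
  leafVec₂-∋ {u} eq = subst (_ ∈_) (sym (toList-leafVec₂ u)) (∈-elements⁺ eq)

  star-in-G : ∀ u → All (λ { (p , q) → T (adj G p q) }) (edgesOf (star u))
  star-in-G u = Equivalence.from T-≡ (F⇒E (F-succ u))
    ∷ AllP.++⁺ (AllP.map⁺ (All.tabulate (Equivalence.from T-≡ ∘ leaf₁⇒E ∘ ∈-leafVec₁)))
               (AllP.map⁺ (All.tabulate (Equivalence.from T-≡ ∘ H⇒E ∘ H⃗⇒H ∘ leaf₂⇒H⃗ ∘ ∈-leafVec₂)))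

  data Covers (u x y : Fin n) : Set where
    via-succ   : SameEdge (u , succ u) x y → Covers u x y
    via-H⃗      : ∀ {w} → H⃗ u w ≡ true → leaf₂ (pred u) w ≡ false → SameEdge (u , w) x y → Covers u x y
    via-mate   : owner u ≡ true → SameEdge (u , mate u) x y → Covers u x y
    via-leaf₂  : ∀ {w} → leaf₂ u w ≡ true → SameEdge (succ u , w) x y → Covers u x y

  StarEdge⇒Covers : ∀ {u x y} → StarEdge (star u) x y → Covers u x y
  StarEdge⇒Covers (inj₁ same) = via-succ same
  StarEdge⇒Covers {u} (inj₂ (inj₁ (w , w∈ , same))) with ∨-true {H⃗ u w ∧ not (leaf₂ (pred u) w)} (∈-leafVec₁ w∈)
  ... | inj₁ unclaimed = via-H⃗ (proj₁ (∧-true unclaimed)) (not-true (proj₂ (∧-true {H⃗ u w} unclaimed))) same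
  ... | inj₂ matched   = via-mate (proj₁ (∧-true matched)) (subst (λ v → SameEdge (u , v) _ _) (matched⇒≡mate matched) same)
  StarEdge⇒Covers (inj₂ (inj₂ (w , w∈ , same))) = via-leaf₂ (∈-leafVec₂ w∈) same

  Covers⇒StarEdge : ∀ {u x y} → Covers u x y → StarEdge (star u) x y
  Covers⇒StarEdge (via-succ same) = inj₁ same
  Covers⇒StarEdge {u} (via-H⃗ {w} H⃗uw unclaimed same) =
    inj₂ (inj₁ (w , leafVec₁-∋ (cong (_∨ (owner u ∧ ⌊ w ≟ mate u ⌋)) (cong₂ _∧_ H⃗uw (cong not unclaimed))) , same))
  Covers⇒StarEdge {u} (via-mate own same) =
    inj₂ (inj₁ (_ , leafVec₁-∋ (trans (cong (H⃗ u (mate u) ∧ not (leaf₂ (pred u) (mate u)) ∨_)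
                                               (cong₂ _∧_ own (⌊⌋-true (mate u ≟ mate u) refl)))
                                         (∨-zeroʳ _)) , same))
  Covers⇒StarEdge (via-leaf₂ l₂ same) = inj₂ (inj₂ (_ , leafVec₂-∋ l₂ , same))

  private
    H⃗-same-dart : ∀ {a b c d x y} → H⃗ a b ≡ true → H⃗ c d ≡ true →
                  SameEdge (a , b) x y → SameEdge (c , d) x y → a ≡ c × b ≡ d
    H⃗-same-dart H⃗ab H⃗cd same same′ with SameEdge-match same same′
    ... | inj₁ eqs = eqs
    ... | inj₂ (refl , refl) = ⊥-elim (orientation-antisym H⃗-orientation H⃗ab H⃗cd)

    F-edge : ∀ {u x y} → SameEdge (u , succ u) x y → F x y ≡ true
    F-edge same = SameEdge-rel F-sym same (F-succ _)

    M-edge : ∀ {u x y} → SameEdge (u , mate u) x y → M x y ≡ true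
    M-edge same = SameEdge-rel M-sym same (M-mate _)

    H-edge : ∀ {a b x y} → H⃗ a b ≡ true → SameEdge (a , b) x y → H x y ≡ true
    H-edge H⃗ab same = SameEdge-rel H-sym same (H⃗⇒H H⃗ab)

    H-and-F : ∀ {x y} → H x y ≡ true → F x y ≡ true → ⊥
    H-and-F Hxy Fxy = true≢false Fxy (H⇒¬F Hxy)

    H-and-M : ∀ {x y} → H x y ≡ true → M x y ≡ true → ⊥
    H-and-M Hxy Mxy = true≢false Mxy (H⇒¬M Hxy)

    F-and-M : ∀ {x y} → F x y ≡ true → M x y ≡ true → ⊥
    F-and-M Fxy Mxy = true≢false Mxy (F⇒¬M Fxy)

    unclaimed-and-leaf₂ : ∀ {u u′ w w′ x y} → H⃗ u w ≡ true → leaf₂ (pred u) w ≡ false → SameEdge (u , w) x y →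
                           leaf₂ u′ w′ ≡ true → SameEdge (succ u′ , w′) x y → ⊥
    unclaimed-and-leaf₂ {u} {u′} H⃗uw unclaimed same l₂ same′
      with refl , refl ← H⃗-same-dart H⃗uw (leaf₂⇒H⃗ l₂) same same′ =
      true≢false (subst (λ v → leaf₂ v _ ≡ true) (sym (pred∘succ u′)) l₂) unclaimed

  covers-unique : ∀ {u u′ x y} → Covers u x y → Covers u′ x y → u ≡ u′
  covers-unique {u} {u′} (via-succ same) (via-succ same′) with SameEdge-match same same′
  ... | inj₁ (u≡u′ , _) = u≡u′
  ... | inj₂ (u≡succ-u′ , succ-u≡u′) = ⊥-elim (orientation-antisym F⃗-orientation (F⃗-succ u)
          (subst₂ (λ s t → F⃗ s t ≡ true) (sym succ-u≡u′) (sym u≡succ-u′) (F⃗-succ u′)))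
  covers-unique (via-H⃗ H⃗uw _ same) (via-H⃗ H⃗uw′ _ same′) = proj₁ (H⃗-same-dart H⃗uw H⃗uw′ same same′)
  covers-unique {u} (via-mate own same) (via-mate own′ same′) with SameEdge-match same same′
  ... | inj₁ (u≡u′ , _) = u≡u′
  ... | inj₂ (_ , mate-u≡u′) = ⊥-elim (true≢false own′ (subst (λ v → owner v ≡ false) mate-u≡u′ (owner-unique u own)))
  covers-unique {u} {u′} (via-leaf₂ l₂ same) (via-leaf₂ l₂′ same′) =
    trans (sym (pred∘succ u))
          (trans (cong pred (proj₁ (H⃗-same-dart (leaf₂⇒H⃗ l₂) (leaf₂⇒H⃗ l₂′) same same′))) (pred∘succ u′))
  covers-unique (via-H⃗ H⃗uw unclaimed same) (via-leaf₂ l₂′ same′) =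
    ⊥-elim (unclaimed-and-leaf₂ H⃗uw unclaimed same l₂′ same′)
  covers-unique (via-leaf₂ l₂ same) (via-H⃗ H⃗uw′ unclaimed′ same′) =
    ⊥-elim (unclaimed-and-leaf₂ H⃗uw′ unclaimed′ same′ l₂ same)
  covers-unique (via-succ same) (via-H⃗ H⃗uw _ same′) = ⊥-elim (H-and-F (H-edge H⃗uw same′) (F-edge same))
  covers-unique (via-H⃗ H⃗uw _ same) (via-succ same′) = ⊥-elim (H-and-F (H-edge H⃗uw same) (F-edge same′))
  covers-unique (via-succ same) (via-leaf₂ l₂ same′) = ⊥-elim (H-and-F (H-edge (leaf₂⇒H⃗ l₂) same′) (F-edge same))
  covers-unique (via-leaf₂ l₂ same) (via-succ same′) = ⊥-elim (H-and-F (H-edge (leaf₂⇒H⃗ l₂) same) (F-edge same′))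
  covers-unique (via-succ same) (via-mate _ same′) = ⊥-elim (F-and-M (F-edge same) (M-edge same′))
  covers-unique (via-mate _ same) (via-succ same′) = ⊥-elim (F-and-M (F-edge same′) (M-edge same))
  covers-unique (via-H⃗ H⃗uw _ same) (via-mate _ same′) = ⊥-elim (H-and-M (H-edge H⃗uw same) (M-edge same′))
  covers-unique (via-mate _ same) (via-H⃗ H⃗uw _ same′) = ⊥-elim (H-and-M (H-edge H⃗uw same′) (M-edge same))
  covers-unique (via-leaf₂ l₂ same) (via-mate _ same′) = ⊥-elim (H-and-M (H-edge (leaf₂⇒H⃗ l₂) same) (M-edge same′))
  covers-unique (via-mate _ same) (via-leaf₂ l₂ same′) = ⊥-elim (H-and-M (H-edge (leaf₂⇒H⃗ l₂) same′) (M-edge same))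

  covered-by-dart : ∀ {t w x y} → H⃗ t w ≡ true → SameEdge (t , w) x y → Σ (Fin n) λ u → Covers u x y
  covered-by-dart {t} {w} H⃗tw same with leaf₂ (pred t) w in claimed
  ... | true  = pred t , via-leaf₂ claimed (subst (λ v → SameEdge (v , w) _ _) (sym (succ∘pred t)) same)
  ... | false = t , via-H⃗ H⃗tw claimed same

  covers-exists : ∀ {x y} → E x y ≡ true → Σ (Fin n) λ u → Covers u x y
  covers-exists {x} {y} Exy with ∨-true {M x y ∨ F x y} (trans (sym (E-partition x y)) Exy)
  ... | inj₂ Hxy with orientation-present H⃗-orientation Hxy
  ...   | inj₁ H⃗xy = covered-by-dart H⃗xy (inj₁ (refl , refl))
  ...   | inj₂ H⃗yx = covered-by-dart H⃗yx (inj₂ (refl , refl))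
  covers-exists {x} {y} Exy | inj₁ MF with ∨-true {M x y} MF
  ... | inj₂ Fxy with orientation-present F⃗-orientation Fxy
  ...   | inj₁ F⃗xy = x , via-succ (inj₁ (refl , sym (succ-unique x F⃗xy)))
  ...   | inj₂ F⃗yx = y , via-succ (inj₂ (refl , sym (succ-unique y F⃗yx)))
  covers-exists {x} {y} Exy | inj₁ MF | inj₁ Mxy with owner x in own
  ... | true  = x , via-mate own (inj₁ (refl , sym (mate-unique x Mxy)))
  ... | false = mate x , via-mate (owner-exists x own) (inj₂ (sym (mate-unique x Mxy) , mate∘mate x))

  decomposition : Decomposable2 G (k₁ , k₂) (suc k₁ , k₂)
  decomposition = tabulate star , AllP.tabulate⁺ (shape ∘ owner) , AllP.tabulate⁺ star-in-G , exactly-once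
    where
    shape : ∀ b → let a = if b then suc k₁ else k₁ in (a ≡ k₁ × k₂ ≡ k₂) ⊎ (a ≡ suc k₁ × k₂ ≡ k₂)
    shape true  = inj₂ (refl , refl)
    shape false = inj₁ (refl , refl)
    exactly-once : ∀ x y → T (adj G x y) → countList (λ S → hasEdge S x y) (tabulate star) ≡ 1
    exactly-once x y t with u , covers ← covers-exists (Equivalence.to T-≡ t) =
      trans (countList-tabulate (λ S → hasEdge S x y) star)
            (unique⇒count≡1 u (StarEdge⇒hasEdge (star u) x y (Covers⇒StarEdge covers))
              λ u′ has → covers-unique (StarEdge⇒Covers (hasEdge⇒StarEdge (star u′) x y has)) covers)

mainTheorem6 : (n k k₁ k₂ : ℕ) (G : Graph n) (M F : Rel n)
    → Regular (2 * k + 1) G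
    → PerfectMatching G M
    → TwoFactorOfMinus G M F
    → 1 ≤ k₁ → 1 ≤ k₂ → k₁ + k₂ ≡ k ∸ 1
    → (∀ u v → T (F u v) → commonNbrs G u v ≤ k₁ ∸ 1)
    → Decomposable2 G (k₁ , k₂) (suc k₁ , k₂)
mainTheorem6 n k k₁ k₂ G M F regular matching factor _ _ k-split few-common =
  Construction.decomposition n k k₁ k₂ G M F regular matching factor k-split few-common
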